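{- In the black-box model with a distance oracle, the worst-case complexity of computing the closest codeword pairs of a binary non-linear code of size $S$ is $\Omega(S^2)$.
   Context: In the black-box model with distance oracle, an algorithm receives a code $X\subseteq(\mathbb{F}_2)^n$ (a set of $S$ points, not necessarily linear) and can only obtain information by calling an oracle returning the Hamming distance $\mathrm{d}(x,y)$ between two given points; it may use previously obtained distances (e.g. through the triangle inequality $\mathrm{d}(x,z)\ge\mathrm{d}(x,y)-\mathrm{d}(y,z)$) to avoid further calls. Complexity is the number of oracle calls, measured in the worst case over codes as $n$ grows. The task is to output a pair of distinct codewords at minimum Hamming distance. -}

module Defs where

open import Data.Nat using (ℕ; zero; suc; _+_; _≤_)
open import Data.Bool using (Bool; true; false; _xor_; if_then_else_)
open import Data.Vec using (Vec; []; _∷_)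
open import Data.Fin using (Fin)
open import Data.Product using (_×_; _,_; proj₁; proj₂)
open import Relation.Binary.PropositionalEquality using (_≡_)
open import Relation.Nullary using (¬_)
open import Function.Definitions using (Injective)

Word : ℕ → Set
Word n = Vec Bool n

hamming : ∀ {n} → Word n → Word n → ℕ
hamming [] [] = 0
hamming (a ∷ x) (b ∷ y) = (if a xor b then 1 else 0) + hamming x y

-- A (not necessarily linear) binary code of size S in (F_2)^n, presented
-- as an enumeration of its S distinct codewords.
IsCode : (S n : ℕ) → (Fin S → Word n) → Set
IsCode S n X = Injective _≡_ _≡_ X

-- Black-box algorithm with distance oracle on a code of size S:
-- an adaptive decision tree.  Any computation between queries
-- (e.g. triangle-inequality reasoning) is free.
data Algo (S : ℕ) : Set where
  output : Fin S → Fin S → Algo S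
  ask    : Fin S → Fin S → (ℕ → Algo S) → Algo S

run : ∀ {S n} → Algo S → (Fin S → Word n) → Fin S × Fin S
run (output i j) X = i , j
run (ask i j k) X = run (k (hamming (X i) (X j))) X

calls : ∀ {S n} → Algo S → (Fin S → Word n) → ℕ
calls (output i j) X = 0
calls (ask i j k) X = suc (calls (k (hamming (X i) (X j))) X)

ClosestPair : ∀ {S n} → (Fin S → Word n) → Fin S × Fin S → Set
ClosestPair X (i , j) =
  ¬ (i ≡ j) × (∀ k l → ¬ (k ≡ l) → hamming (X i) (X j) ≤ hamming (X k) (X l))

Correct : (S n : ℕ) → Algo S → Set
Correct S n A = ∀ (X : Fin S → Word n) → IsCode S n X → ClosestPair X (run A X)

module Submission where

-- An adversary argument.  Give codeword i of a size-S code the two coordinates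
-- "slot (i,0)" and "slot (i,1)" (distinct coordinates below 2S, via `combine`):
-- the resulting hard code X has all pairwise distances equal to 4.  For k ≢ l
-- the fooling code Y moves codeword l onto the slots (k,0) and (l,0); then
-- d(Y k, Y l) = 2 while every other pair of Y keeps distance 4.  If a correct
-- algorithm, run on X, never queried {k,l} in either orientation nor answered
-- it, then all its oracle answers on Y coincide with those on X, so it gives
-- the same answer on Y, which is not a closest pair of Y.  Hence every
-- unordered pair of distinct indices occurs among the queries or the answer,
-- and counting ordered pairs gives S² ≤ 2 (calls + 1) + S, i.e. S² ≤ 4 calls
-- once S ≥ 4.

open import Defs
open import Data.Nat using (ℕ; zero; suc; _+_; _*_; _≤_; _<_; z≤n; s≤s)
open import Data.Nat.Properties using (+-suc; <-irrefl; <-≤-trans; ≤-trans; m≤m+n; +-monoʳ-≤; +-mono-≤; *-monoˡ-≤; +-cancelʳ-≤; module ≤-Reasoning)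
open import Data.Nat.Tactic.RingSolver using (solve-∀)
open import Data.Bool using (Bool; false; not)
open import Data.Bool.Properties using (xor-same; xor-comm; not-involutive; not-distribˡ-xor; not-distribʳ-xor)
open import Data.Vec using ([]; _∷_; replicate)
open import Data.Fin using (Fin; toℕ; combine; remQuot; _≟_)
open import Data.Fin.Patterns using (0F; 1F)
open import Data.Fin.Properties using (toℕ-injective; toℕ<n; combine-injectiveˡ; combine-injectiveʳ; combine-remQuot; injective⇒≤)
open import Data.Product using (Σ; _×_; _,_; proj₁; ∃-syntax; swap; uncurry)
open import Data.Product.Properties using (≡-dec)
open import Data.Sum using (_⊎_; inj₁; inj₂)
open import Data.Empty using (⊥; ⊥-elim)
open import Data.List using (List; []; _∷_; _++_; length; map; foldr; allFin)
open import Data.List.Properties using (foldr-++; length-++; length-map; length-tabulate)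
open import Data.List.Membership.Propositional using (_∈_; _∉_)
open import Data.List.Membership.Propositional.Properties using (∈-map⁺; ∈-++⁺ˡ; ∈-++⁺ʳ; ∈-allFin)
open import Data.List.Membership.Setoid.Properties using (index-injective)
open import Data.List.Relation.Unary.Any using (here; there; any?)
open import Data.List.Relation.Unary.All using (All; []; _∷_)
open import Data.List.Relation.Unary.Unique.Propositional using (Unique; []; _∷_)
open import Data.List.Relation.Unary.Unique.Propositional.Properties as Unique using ()
open import Function using (_∘_)
open import Function.Definitions using (Injective)
open import Relation.Nullary using (¬_; yes; no)
open import Relation.Binary.PropositionalEquality

-- Bit flips of words.  Coordinates are natural numbers; a flip beyond the
-- length of the word does nothing.

flipBit : ∀ {n} → ℕ → Word n → Word n
flipBit _       []      = []
flipBit zero    (b ∷ x) = not b ∷ x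
flipBit (suc p) (b ∷ x) = b ∷ flipBit p x

bitAt : ∀ {n} → Word n → ℕ → Bool
bitAt []      _       = false
bitAt (b ∷ x) zero    = b
bitAt (b ∷ x) (suc p) = bitAt x p

flips : ∀ {n} → List ℕ → Word n → Word n
flips ps x = foldr flipBit x ps

zeros : ∀ n → Word n
zeros n = replicate n false

indicator : ∀ n → List ℕ → Word n
indicator n ps = flips ps (zeros n)

weight : ∀ {n} → Word n → ℕ
weight {n} w = hamming (zeros n) w

-- Flips are involutive and commute with each other; these let the two flips
-- on a shared coordinate cancel and let flips pass to the other argument of
-- the distance.
flipBit-involutive : ∀ {n} p (x : Word n) → flipBit p (flipBit p x) ≡ x
flipBit-involutive _       []      = refl
flipBit-involutive zero    (b ∷ x) = cong (_∷ x) (not-involutive b)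
flipBit-involutive (suc p) (b ∷ x) = cong (b ∷_) (flipBit-involutive p x)

flipBit-comm : ∀ {n} p q (x : Word n) → flipBit p (flipBit q x) ≡ flipBit q (flipBit p x)
flipBit-comm _       _       []      = refl
flipBit-comm zero    zero    (b ∷ x) = refl
flipBit-comm zero    (suc q) (b ∷ x) = refl
flipBit-comm (suc p) zero    (b ∷ x) = refl
flipBit-comm (suc p) (suc q) (b ∷ x) = cong (b ∷_) (flipBit-comm p q x)

flipBit-flips : ∀ {n} p qs (x : Word n) → flipBit p (flips qs x) ≡ flips qs (flipBit p x)
flipBit-flips p []       x = refl
flipBit-flips p (q ∷ qs) x = trans (flipBit-comm p q _) (cong (flipBit q) (flipBit-flips p qs x))

bitAt-flipBit : ∀ {n} q p (x : Word n) → q ≢ p → bitAt (flipBit q x) p ≡ bitAt x p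
bitAt-flipBit _       _       []      _   = refl
bitAt-flipBit zero    zero    (b ∷ x) q≢p = ⊥-elim (q≢p refl)
bitAt-flipBit zero    (suc p) (b ∷ x) _   = refl
bitAt-flipBit (suc q) zero    (b ∷ x) _   = refl
bitAt-flipBit (suc q) (suc p) (b ∷ x) q≢p = bitAt-flipBit q p x (q≢p ∘ cong suc)

bitAt-flips : ∀ {n} p qs (x : Word n) → All (p ≢_) qs → bitAt (flips qs x) p ≡ bitAt x p
bitAt-flips p []       x []           = refl
bitAt-flips p (q ∷ qs) x (p≢q ∷ p∉qs) =
  trans (bitAt-flipBit q p (flips qs x) (p≢q ∘ sym)) (bitAt-flips p qs x p∉qs)

bitAt-zeros : ∀ n p → bitAt (zeros n) p ≡ false
bitAt-zeros zero    p       = refl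
bitAt-zeros (suc n) zero    = refl
bitAt-zeros (suc n) (suc p) = bitAt-zeros n p

hamming-self : ∀ {n} (x : Word n) → hamming x x ≡ 0
hamming-self []      = refl
hamming-self (b ∷ x) rewrite xor-same b = hamming-self x

hamming-sym : ∀ {n} (x y : Word n) → hamming x y ≡ hamming y x
hamming-sym []      []      = refl
hamming-sym (a ∷ x) (b ∷ y) rewrite xor-comm a b | hamming-sym x y = refl

hamming-flipBit : ∀ {n} p (x y : Word n) → hamming (flipBit p x) y ≡ hamming x (flipBit p y)
hamming-flipBit _       []      []      = refl
hamming-flipBit zero    (a ∷ x) (b ∷ y)
  rewrite sym (not-distribˡ-xor a b) | not-distribʳ-xor a b = refl
hamming-flipBit (suc p) (a ∷ x) (b ∷ y) = cong (_ +_) (hamming-flipBit p x y)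

hamming-flips : ∀ {n} ps (x y : Word n) → hamming (flips ps x) y ≡ hamming x (flips ps y)
hamming-flips []       x y = refl
hamming-flips (p ∷ ps) x y = begin
  hamming (flipBit p (flips ps x)) y  ≡⟨ hamming-flipBit p (flips ps x) y ⟩
  hamming (flips ps x) (flipBit p y)  ≡⟨ hamming-flips ps x _ ⟩
  hamming x (flips ps (flipBit p y))  ≡⟨ cong (hamming x) (flipBit-flips p ps y) ⟨
  hamming x (flipBit p (flips ps y))  ∎
  where open ≡-Reasoning

weight-flipBit : ∀ {n} p (w : Word n) → p < n → bitAt w p ≡ false →
                 weight (flipBit p w) ≡ suc (weight w)
weight-flipBit zero    (false ∷ w) _         _  = refl
weight-flipBit (suc p) (b ∷ w)     (s≤s p<n) bp =
  trans (cong (_ +_) (weight-flipBit p w p<n bp)) (+-suc _ _)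

weight-indicator : ∀ {n} ps → Unique ps → All (_< n) ps → weight (indicator n ps) ≡ length ps
weight-indicator {n = n} []       []             []           = hamming-self (zeros n)
weight-indicator {n = n} (p ∷ ps) (p∉ps ∷ uniq)  (p<n ∷ ps<n) = begin
  weight (flipBit p (indicator n ps))  ≡⟨ weight-flipBit p _ p<n p-unset ⟩
  suc (weight (indicator n ps))        ≡⟨ cong suc (weight-indicator ps uniq ps<n) ⟩
  suc (length ps)                      ∎
  where
  open ≡-Reasoning
  p-unset : bitAt (indicator n ps) p ≡ false
  p-unset = trans (bitAt-flips p ps (zeros n) p∉ps) (bitAt-zeros n p)

hamming-indicator : ∀ {n} ps qs →
                    hamming (indicator n ps) (indicator n qs) ≡ weight (indicator n (ps ++ qs))
hamming-indicator {n} ps qs =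
  trans (hamming-flips ps (zeros n) _) (cong weight (sym (foldr-++ flipBit (zeros n) ps qs)))

separated⇒isCode : ∀ {S n} (C : Fin S → Word n) →
                   (∀ {i j} → i ≢ j → 0 < hamming (C i) (C j)) → IsCode S n C
separated⇒isCode C separated {i} {j} Ci≡Cj with i ≟ j
... | yes i≡j = i≡j
... | no  i≢j = ⊥-elim (<-irrefl (sym distance-zero) (separated i≢j))
  where
  distance-zero : hamming (C i) (C j) ≡ 0
  distance-zero = trans (cong (hamming (C i)) (sym Ci≡Cj)) (hamming-self (C i))

pairWord : ∀ n → ℕ → ℕ → Word n
pairWord n a b = indicator n (a ∷ b ∷ [])

pairWord-disjoint : ∀ {n} a b c d → Unique (a ∷ b ∷ c ∷ d ∷ []) → All (_< n) (a ∷ b ∷ c ∷ d ∷ []) →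
                    hamming (pairWord n a b) (pairWord n c d) ≡ 4
pairWord-disjoint {n} a b c d distinct bounded =
  trans (hamming-indicator {n} (a ∷ b ∷ []) (c ∷ d ∷ [])) (weight-indicator _ distinct bounded)

pairWord-share : ∀ {n} a b c → b ≢ c → b < n → c < n →
                 hamming (pairWord n a b) (pairWord n a c) ≡ 2
pairWord-share {n} a b c b≢c b<n c<n = begin
  hamming (pairWord n a b) (pairWord n a c)          ≡⟨ hamming-indicator {n} (a ∷ b ∷ []) (a ∷ c ∷ []) ⟩
  weight (flipBit a (flipBit b (flipBit a bc)))      ≡⟨ cong (weight ∘ flipBit a) (flipBit-comm b a bc) ⟩
  weight (flipBit a (flipBit a (flipBit b bc)))      ≡⟨ cong weight (flipBit-involutive a (flipBit b bc)) ⟩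
  weight (indicator n (b ∷ c ∷ []))                  ≡⟨ weight-indicator (b ∷ c ∷ []) ((b≢c ∷ []) ∷ [] ∷ []) (b<n ∷ c<n ∷ []) ⟩
  2                                                  ∎
  where
  open ≡-Reasoning
  bc : Word n
  bc = indicator n (c ∷ [])

-- Slots: codeword index i owns the two coordinates of slots (i , 0) and
-- (i , 1); distinct slots of a size-S code are distinct coordinates below 2S.

Slot : ℕ → Set
Slot S = Fin S × Fin 2

coord : ∀ {S} → Slot S → ℕ
coord (i , b) = toℕ (combine i b)

coord-injective : ∀ {S} → Injective _≡_ _≡_ (coord {S})
coord-injective {x = i , b} {y = j , c} eq =
  cong₂ _,_ (combine-injectiveˡ i b j c same) (combine-injectiveʳ i b j c same)
  where same = toℕ-injective eq

coord-bound : ∀ {S n} → S * 2 ≤ n → (u : Slot S) → coord u < n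
coord-bound room (i , b) = <-≤-trans (toℕ<n (combine i b)) room

slotWord : ∀ {S} n → Slot S → Slot S → Word n
slotWord n u v = pairWord n (coord u) (coord v)

slotWord-disjoint : ∀ {S n} → S * 2 ≤ n → (u v w x : Slot S) → Unique (u ∷ v ∷ w ∷ x ∷ []) →
                    hamming (slotWord n u v) (slotWord n w x) ≡ 4
slotWord-disjoint room u v w x distinct =
  pairWord-disjoint _ _ _ _ (Unique.map⁺ coord-injective distinct)
    (bound u ∷ bound v ∷ bound w ∷ bound x ∷ [])
  where bound = coord-bound room

slotWord-share : ∀ {S n} → S * 2 ≤ n → (u v w : Slot S) → v ≢ w →
                 hamming (slotWord n u v) (slotWord n u w) ≡ 2
slotWord-share room u v w v≢w =
  pairWord-share _ _ _ (v≢w ∘ coord-injective) (coord-bound room v) (coord-bound room w)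

module HardCode {S n : ℕ} (room : S * 2 ≤ n) where

  X : Fin S → Word n
  X i = slotWord n (i , 0F) (i , 1F)

  X-distance : ∀ {i j} → i ≢ j → hamming (X i) (X j) ≡ 4
  X-distance {i} {j} i≢j = slotWord-disjoint room _ _ _ _
    (((λ ()) ∷ other ∷ (λ ()) ∷ []) ∷ ((λ ()) ∷ other ∷ []) ∷ ((λ ()) ∷ []) ∷ [] ∷ [])
    where
    other : ∀ {b} → (i , b) ≢ (j , b)
    other = i≢j ∘ cong proj₁

  X-isCode : IsCode S n X
  X-isCode = separated⇒isCode X (λ i≢j → subst (0 <_) (sym (X-distance i≢j)) (s≤s z≤n))

  -- For k ≢ l, codeword l is moved onto the slots (k , 0) and (l , 0),
  -- so that it comes at distance 2 from codeword k.
  module Fooling (k l : Fin S) (k≢l : k ≢ l) where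

    moved : Word n
    moved = slotWord n (k , 0F) (l , 0F)

    Y : Fin S → Word n
    Y m with m ≟ l
    ... | yes _ = moved
    ... | no  _ = X m

    Avoids : Fin S × Fin S → Set
    Avoids ab = ab ≢ (k , l) × ab ≢ (l , k)

    moved-distance : ∀ {b} → b ≢ k → b ≢ l → hamming moved (X b) ≡ 4
    moved-distance {b} b≢k b≢l = slotWord-disjoint room _ _ _ _
      (((k≢l ∘ cong proj₁) ∷ (b≢k ∘ sym ∘ cong proj₁) ∷ (λ ()) ∷ [])
       ∷ ((b≢l ∘ sym ∘ cong proj₁) ∷ (λ ()) ∷ []) ∷ ((λ ()) ∷ []) ∷ [] ∷ [])

    Y-close : hamming (Y k) (Y l) ≡ 2
    Y-close with k ≟ l | l ≟ l
    ... | yes k≡l | _       = ⊥-elim (k≢l k≡l)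
    ... | no _    | no l≢l  = ⊥-elim (l≢l refl)
    ... | no _    | yes _   = slotWord-share room (k , 0F) (k , 1F) (l , 0F) (λ ())

    Y-far : ∀ {a b} → a ≢ b → Avoids (a , b) → hamming (Y a) (Y b) ≡ 4
    Y-far {a} {b} a≢b (≢kl , ≢lk) with a ≟ l | b ≟ l
    ... | yes refl | yes refl = ⊥-elim (a≢b refl)
    ... | yes refl | no b≢l   = moved-distance (≢lk ∘ cong (l ,_)) b≢l
    ... | no a≢l   | yes refl =
      trans (hamming-sym (X a) moved) (moved-distance (≢kl ∘ cong (_, l)) a≢l)
    ... | no _     | no _     = X-distance a≢b

    Y-isCode : IsCode S n Y
    Y-isCode = separated⇒isCode Y separated
      where
      separated : ∀ {a b} → a ≢ b → 0 < hamming (Y a) (Y b)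
      separated {a} {b} a≢b with ≡-dec _≟_ _≟_ (a , b) (k , l) | ≡-dec _≟_ _≟_ (a , b) (l , k)
      ... | yes refl | _        = subst (0 <_) (sym Y-close) (s≤s z≤n)
      ... | no _     | yes refl = subst (0 <_) (sym (trans (hamming-sym (Y l) (Y k)) Y-close)) (s≤s z≤n)
      ... | no ≢kl   | no ≢lk   = subst (0 <_) (sym (Y-far a≢b (≢kl , ≢lk))) (s≤s z≤n)

queries : ∀ {S n} → Algo S → (Fin S → Word n) → List (Fin S × Fin S)
queries (output i j) C = []
queries (ask i j next) C = (i , j) ∷ queries (next (hamming (C i) (C j))) C

length-queries : ∀ {S n} (A : Algo S) (C : Fin S → Word n) → length (queries A C) ≡ calls A C
length-queries (output i j)    C = refl
length-queries (ask i j next) C = cong suc (length-queries (next _) C)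

run-determined : ∀ {S n} (A : Algo S) (C D : Fin S → Word n) →
                 (∀ {a b} → (a , b) ∈ queries A C → hamming (D a) (D b) ≡ hamming (C a) (C b)) →
                 run A D ≡ run A C
run-determined (output i j)    C D agree = refl
run-determined (ask i j next) C D agree rewrite agree (here refl) =
  run-determined (next _) C D (agree ∘ there)

covering-length : ∀ {m} {A : Set} (f : Fin m → A) → Injective _≡_ _≡_ f →
                  (L : List A) → (∀ i → f i ∈ L) → m ≤ length L
covering-length f f-injective L covered =
  injective⇒≤ (λ same-index → f-injective (index-injective (setoid _) (covered _) (covered _) same-index))

-- If every pair of distinct indices occurs in R in some orientation, then the
-- S² ordered pairs are covered by R, its swap and the diagonal.
pair-cover-bound : ∀ {S} (R : List (Fin S × Fin S)) →
                   (∀ k l → k ≢ l → (k , l) ∈ R ⊎ (l , k) ∈ R) →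
                   S * S ≤ length R + (length R + S)
pair-cover-bound {S} R meets = subst (S * S ≤_) size
  (covering-length (remQuot S) remQuot-injective L covered)
  where
  diagonal : List (Fin S × Fin S)
  diagonal = map (λ k → (k , k)) (allFin S)

  L : List (Fin S × Fin S)
  L = R ++ map swap R ++ diagonal

  remQuot-injective : Injective _≡_ _≡_ (remQuot {S} S)
  remQuot-injective {x} {y} eq =
    trans (sym (combine-remQuot {S} S x)) (trans (cong (uncurry combine) eq) (combine-remQuot {S} S y))

  covered-pair : ∀ k l → (k , l) ∈ L
  covered-pair k l with k ≟ l
  ... | yes refl = ∈-++⁺ʳ R (∈-++⁺ʳ (map swap R) (∈-map⁺ (λ k → (k , k)) (∈-allFin k)))
  ... | no k≢l with meets k l k≢l
  ...   | inj₁ kl∈R = ∈-++⁺ˡ kl∈R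
  ...   | inj₂ lk∈R = ∈-++⁺ʳ R (∈-++⁺ˡ (∈-map⁺ swap lk∈R))

  covered : ∀ i → remQuot S i ∈ L
  covered i = covered-pair _ _

  size : length L ≡ length R + (length R + S)
  size = begin
    length L                                                ≡⟨ length-++ R ⟩
    length R + length (map swap R ++ diagonal)              ≡⟨ cong (length R +_) (length-++ (map swap R)) ⟩
    length R + (length (map swap R) + length diagonal)      ≡⟨ cong (λ d → length R + (length (map swap R) + d)) diagonal-size ⟩
    length R + (length (map swap R) + S)                    ≡⟨ cong (λ s → length R + (s + S)) (length-map swap R) ⟩
    length R + (length R + S)                               ∎
    where
    open ≡-Reasoning
    diagonal-size : length diagonal ≡ S
    diagonal-size = trans (length-map _ (allFin S)) (length-tabulate _)

module Adversary {S n : ℕ} (room : S * 2 ≤ n) (A : Algo S) (correct : Correct S n A) where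
  open HardCode {S} {n} room

  inspected : List (Fin S × Fin S)
  inspected = run A X ∷ queries A X

  module _ (k l : Fin S) (k≢l : k ≢ l) (kl∉ : (k , l) ∉ inspected) (lk∉ : (l , k) ∉ inspected) where
    open Fooling k l k≢l

    avoids : ∀ {ab} → ab ∈ inspected → Avoids ab
    avoids ab∈ = (λ { refl → kl∉ ab∈ }) , (λ { refl → lk∉ ab∈ })

    agree : ∀ {a b} → (a , b) ∈ queries A X → hamming (Y a) (Y b) ≡ hamming (X a) (X b)
    agree {a} {b} ab∈ with a ≟ b
    ... | yes refl = trans (hamming-self (Y a)) (sym (hamming-self (X a)))
    ... | no a≢b   = trans (Y-far a≢b (avoids (there ab∈))) (sym (X-distance a≢b))

    not-closest : ∀ {o} → o ∈ inspected → ¬ ClosestPair Y o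
    not-closest {i , j} o∈ (i≢j , minimal) = 4≰2 (begin
      4                  ≡⟨ Y-far i≢j (avoids o∈) ⟨
      hamming (Y i) (Y j) ≤⟨ minimal k l k≢l ⟩
      hamming (Y k) (Y l) ≡⟨ Y-close ⟩
      2                  ∎)
      where
      open ≤-Reasoning
      4≰2 : ¬ 4 ≤ 2
      4≰2 (s≤s (s≤s ()))

    unseen-pair-impossible : ⊥
    unseen-pair-impossible = not-closest (here refl)
      (subst (ClosestPair Y) (run-determined A X Y agree) (correct Y Y-isCode))

  every-pair-inspected : ∀ k l → k ≢ l → (k , l) ∈ inspected ⊎ (l , k) ∈ inspected
  every-pair-inspected k l k≢l with any? (≡-dec _≟_ _≟_ (k , l)) inspected
                                  | any? (≡-dec _≟_ _≟_ (l , k)) inspected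
  ... | yes kl∈ | _       = inj₁ kl∈
  ... | no _    | yes lk∈ = inj₂ lk∈
  ... | no kl∉  | no lk∉  = ⊥-elim (unseen-pair-impossible k l k≢l kl∉ lk∉)

  square-bound : S * S ≤ suc (calls A X) + (suc (calls A X) + S)
  square-bound = subst (λ r → S * S ≤ r + (r + S)) (cong suc (length-queries A X))
    (pair-cover-bound inspected every-pair-inspected)

quadratic-bound : ∀ S c → 4 ≤ S → S * S ≤ suc c + (suc c + S) → S * S ≤ 4 * c
quadratic-bound S c 4≤S counted = +-cancelʳ-≤ (S + S + 4) (S * S) (4 * c) (begin
  S * S + (S + S + 4)                          ≤⟨ +-monoʳ-≤ (S * S) linear≤square ⟩
  S * S + S * S                                ≤⟨ +-mono-≤ counted counted ⟩
  suc c + (suc c + S) + (suc c + (suc c + S))  ≡⟨ regroup S c ⟩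
  4 * c + (S + S + 4)                          ∎)
  where
  open ≤-Reasoning
  regroup : ∀ S c → suc c + (suc c + S) + (suc c + (suc c + S)) ≡ 4 * c + (S + S + 4)
  regroup = solve-∀
  quadruple : ∀ S → S + S + (S + S) ≡ 4 * S
  quadruple = solve-∀
  linear≤square : S + S + 4 ≤ S * S
  linear≤square = begin
    S + S + 4        ≤⟨ +-monoʳ-≤ (S + S) (≤-trans 4≤S (m≤m+n S S)) ⟩
    S + S + (S + S)  ≡⟨ quadruple S ⟩
    4 * S            ≤⟨ *-monoˡ-≤ S 4≤S ⟩
    S * S            ∎

mainTheorem15 : ∃[ c ] (0 < c × ∃[ S₀ ] (∀ S → S₀ ≤ S → ∃[ n₀ ] (∀ n → n₀ ≤ n →
                  ∀ (A : Algo S) → Correct S n A →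
                  Σ (Fin S → Word n) (λ X → IsCode S n X × S * S ≤ c * calls A X))))
mainTheorem15 = 4 , s≤s z≤n , 4 , λ S 4≤S → S * 2 , λ n room A correct →
  let open Adversary {S} {n} room A correct
      open HardCode {S} {n} room
  in X , X-isCode , quadratic-bound S (calls A X) 4≤S square-bound
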